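{- Let $(G',k')$ be obtained from an instance $(G,k)$ (with $G$ connected) by applying Rules 1–4 below exhaustively (until none applies), and let $S$ be the set of vertices marked during this process. Then $G-S$ is a clique-forest.
   Context: $G-X$ denotes the subgraph induced by $V(G)\setminus X$. A block of a graph is a maximal $2$-connected subgraph; a clique-forest is a graph all of whose blocks are cliques. The rules act on a connected graph $G$ and integer $k$: Rule 1: if there are $v\in V(G)$ and $X\subseteq V(G)$ such that $X$ is a connected component of $G-\{v\}$ and $X\cup\{v\}$ is a clique, remove $X$, mark nothing; decrease $k$ by $1$ if $|X|$ is odd. Rule 2: applicable only if Rule 1 is not applicable; if there are $v$ and $X$ such that $X$ is a connected component of $G-\{v\}$ and $X$ is a clique, remove $X$, mark $v$, decrease $k$ by $2$. Rule 3: if there are $a,b,c$ with $\{a,b\},\{b,c\}\in E(G)$, $\{a,c\}\notin E(G)$ and $G-\{a,b,c\}$ connected, remove $a,b,c$, mark $a,b,c$, decrease $k$ by $1$. Rule 4: if there are nonadjacent $x,y$ such that $G-\{x,y\}$ has exactly two connected components $X$ and $Y$ with $X\cup\{x\}$ and $X\cup\{y\}$ cliques, remove $\{x,y\}\cup X$, mark $x,y$, decrease $k$ by $1$. -}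

module Defs where

open import Data.Nat using (ℕ; _%_; _≤_)
open import Data.Integer using (ℤ; +_; _-_)
open import Data.Fin using (Fin)
open import Data.Fin.Subset
  using (Subset; _∈_; _∉_; _⊆_; _∩_; _∪_; _─_; ⁅_⁆; ∁; ⊤; ⊥; ∣_∣; Nonempty; Empty)
open import Data.Product using (Σ; ∃; ∃-syntax; _×_; _,_)
open import Data.Sum using (_⊎_)
open import Relation.Nullary using (¬_; Dec)
open import Relation.Binary.PropositionalEquality using (_≡_; _≢_)
open import Relation.Binary.Construct.Closure.ReflexiveTransitive using (Star)

record SimpleGraph (n : ℕ) : Set₁ where
  field
    Adj    : Fin n → Fin n → Set
    sym    : ∀ {u v} → Adj u v → Adj v u
    irrefl : ∀ {u} → ¬ Adj u u
    dec    : ∀ u v → Dec (Adj u v)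
open SimpleGraph public

module _ {n : ℕ} (G : SimpleGraph n) where

  data Reach (W : Subset n) : Fin n → Fin n → Set where
    here  : ∀ {u} → u ∈ W → Reach W u u
    there : ∀ {u w v} → u ∈ W → Adj G u w → Reach W w v → Reach W u v

  -- G[W] is connected (the empty vertex set counts as connected)
  Connected : Subset n → Set
  Connected W = ∀ {u v} → u ∈ W → v ∈ W → Reach W u v

  Component : Subset n → Subset n → Set
  Component W X =
    X ⊆ W × Nonempty X × Connected X ×
    (∀ {u w} → u ∈ X → w ∈ W → Adj G u w → w ∈ X)

  Clique : Subset n → Set
  Clique X = ∀ {u v} → u ∈ X → v ∈ X → u ≢ v → Adj G u v

  TwoConnected : Subset n → Set
  TwoConnected B = 3 ≤ ∣ B ∣ × Connected B × (∀ {v} → v ∈ B → Connected (B ─ ⁅ v ⁆))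

  Block : Subset n → Subset n → Set
  Block W B = B ⊆ W × TwoConnected B ×
              (∀ B' → B ⊆ B' → B' ⊆ W → TwoConnected B' → B' ⊆ B)

  CliqueForest : Subset n → Set
  CliqueForest W = ∀ B → Block W B → Clique B

  -- Reduction process. A state records the current vertex set A (the
  -- current graph is G[A]), the set M of marked vertices, and k.

  record State : Set where
    constructor ⟨_,_,_⟩
    field
      alive  : Subset n
      marked : Subset n
      param  : ℤ

  Rule1Applies : Subset n → Fin n → Subset n → Set
  Rule1Applies A v X = v ∈ A × Component (A ─ ⁅ v ⁆) X × Clique (X ∪ ⁅ v ⁆)

  data Step : State → State → Set where
    rule1 : ∀ {A M k v X} → Rule1Applies A v X →
            Step ⟨ A , M , k ⟩ ⟨ A ─ X , M , k - + (∣ X ∣ % 2) ⟩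
    rule2 : ∀ {A M k v X} →
            ¬ (∃[ v' ] ∃[ X' ] Rule1Applies A v' X') →
            v ∈ A → Component (A ─ ⁅ v ⁆) X → Clique X →
            Step ⟨ A , M , k ⟩ ⟨ A ─ X , M ∪ ⁅ v ⁆ , k - + 2 ⟩
    rule3 : ∀ {A M k a b c} →
            a ∈ A → b ∈ A → c ∈ A → a ≢ c →
            Adj G a b → Adj G b c → ¬ Adj G a c →
            Connected (A ─ (⁅ a ⁆ ∪ ⁅ b ⁆ ∪ ⁅ c ⁆)) →
            Step ⟨ A , M , k ⟩
                 ⟨ A ─ (⁅ a ⁆ ∪ ⁅ b ⁆ ∪ ⁅ c ⁆) , M ∪ (⁅ a ⁆ ∪ ⁅ b ⁆ ∪ ⁅ c ⁆) , k - + 1 ⟩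
    rule4 : ∀ {A M k x y X Y} →
            x ∈ A → y ∈ A → x ≢ y → ¬ Adj G x y →
            -- G[A] - {x,y} has exactly two components X and Y
            Component (A ─ (⁅ x ⁆ ∪ ⁅ y ⁆)) X →
            Component (A ─ (⁅ x ⁆ ∪ ⁅ y ⁆)) Y →
            Empty (X ∩ Y) →
            (A ─ (⁅ x ⁆ ∪ ⁅ y ⁆)) ⊆ X ∪ Y →
            Clique (X ∪ ⁅ x ⁆) → Clique (X ∪ ⁅ y ⁆) →
            Step ⟨ A , M , k ⟩
                 ⟨ A ─ ((⁅ x ⁆ ∪ ⁅ y ⁆) ∪ X) , M ∪ (⁅ x ⁆ ∪ ⁅ y ⁆) , k - + 1 ⟩

  Exhausted : State → Set
  Exhausted s = ∀ s' → ¬ Step s s'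

  Steps : State → State → Set
  Steps = Star Step

module Submission where

-- The proof combines two facts about the reduction process.
--  * An invariant (`steps-preserve-invariant`): the current graph G[A] stays
--    connected, and every 2-connected vertex set B that avoids the marked
--    vertices and is not a clique stays inside A.  Rules 1, 2 and 4 delete a
--    component X of G[A] minus a separator; a 2-connected B meeting X is
--    trapped in X together with the separator, which is a clique there.
--    Rule 3 marks everything it deletes.
--  * Exhaustion empties the graph (`exhausted-is-trivial`): a connected G[A]
--    to which no rule applies has at most one vertex.  Otherwise take a
--    vertex v and a component X of G[A] - v of minimum size.  If X is a clique
--    Rule 2 applies.  Otherwise X contains an induced path a–b–c; choosing
--    one for which the component K of v in G[A] - {a,b,c} is largest, Rule 3
--    must fail, and a vertex outside K yields either an application of
--    Rule 4, a smaller component than X, or an induced path with larger K.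
-- A non-clique block of G - S is then a 2-connected non-clique set inside the
-- final graph, which has at most one vertex: a contradiction.

open import Defs
open import Data.Nat using (ℕ; _<_; _∸_; s≤s)
open import Data.Nat.Properties using (≤-<-trans; <-≤-trans; ≤-pred; ∸-monoʳ-<)
open import Data.Nat.Induction using (<-rec)
open import Data.Integer using (ℤ)
open import Data.Fin using (Fin; zero; suc)
open import Data.Fin.Properties using (any?) renaming (_≟_ to _≟F_)
open import Data.Fin.Subset
open import Data.Fin.Subset.Properties
open import Data.Product using (∃; _×_; _,_; proj₁; proj₂)
open import Data.Sum using (_⊎_; inj₁; inj₂; [_,_]′)
open import Data.Empty using (⊥-elim) renaming (⊥ to False)
open import Data.Vec.Base using (_∷_; []; _[_]=_)
open _[_]=_ using (here; there)
open import Relation.Nullary using (¬_; Dec; yes; no; does; contradiction)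
open import Relation.Nullary.Decidable using (_×-dec_)
open import Relation.Binary.PropositionalEquality
  using (_≡_; _≢_; refl; subst; trans; ≢-sym) renaming (sym to ≡-sym)
open import Relation.Binary.Construct.Closure.ReflexiveTransitive using (ε; _◅_)

refute-by-induction : ∀ {I : Set} (μ : I → ℕ) {P : I → Set} →
                      (∀ i → (∀ j → μ j < μ i → ¬ P j) → ¬ P i) → ∀ i → ¬ P i
refute-by-induction {I} μ {P} step i = <-rec Refuted refute (μ i) i refl
  where
  Refuted : ℕ → Set
  Refuted m = ∀ i → μ i ≡ m → ¬ P i
  refute : ∀ m → (∀ {m'} → m' < m → Refuted m') → Refuted m
  refute m ih i refl = step i (λ j μj<μi → ih μj<μi j refl)

∈─⇒∉ : ∀ {n} {x : Fin n} {p q : Subset n} → x ∈ p ─ q → x ∉ q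
∈─⇒∉ {p = _ ∷ _} {inside ∷ _} () here
∈─⇒∉ {p = _ ∷ p} {_ ∷ q} (there x∈) (there x∈q) = ∈─⇒∉ {p = p} {q} x∈ x∈q

∈─⇒∈ : ∀ {n} {x : Fin n} {p q : Subset n} → x ∈ p ─ q → x ∈ p
∈─⇒∈ {p = p} {q} = p─q⊆p p q

∈─⇒∈─ : ∀ {n} {x : Fin n} {p q r : Subset n} → x ∈ p ─ q → x ∉ r → x ∈ p ─ r
∈─⇒∈─ x∈ x∉r = x∈p∧x∉q⇒x∈p─q (∈─⇒∈ x∈) x∉r

∈∁∪⇒∈∁ : ∀ {n} {x : Fin n} {p q : Subset n} → x ∈ ∁ (p ∪ q) → x ∈ ∁ p
∈∁∪⇒∈∁ {q = q} x∈ = x∉p⇒x∈∁p (λ x∈p → x∈∁p⇒x∉p x∈ (p⊆p∪q q x∈p))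

∈∁∪⇒∉ : ∀ {n} {x : Fin n} {p q : Subset n} → x ∈ ∁ (p ∪ q) → x ∉ q
∈∁∪⇒∉ {p = p} {q} x∈ x∈q = x∈∁p⇒x∉p x∈ (q⊆p∪q p q x∈q)

select : ∀ {n} {P : Fin n → Set} → (∀ x → Dec (P x)) → Subset n
select {ℕ.zero} P? = []
select {ℕ.suc n} P? = does (P? zero) ∷ select (λ x → P? (suc x))

select⁺ : ∀ {n} {P : Fin n → Set} (P? : ∀ x → Dec (P x)) {x} → P x → x ∈ select P?
select⁺ P? {zero} Px with P? zero
... | yes _ = here
... | no ¬Px = contradiction Px ¬Px
select⁺ P? {suc x} Px = there (select⁺ (λ y → P? (suc y)) Px)

select⁻ : ∀ {n} {P : Fin n → Set} (P? : ∀ x → Dec (P x)) {x} → x ∈ select P? → P x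
select⁻ P? {zero} x∈ with P? zero
select⁻ P? {zero} x∈ | yes Px = Px
select⁻ P? {zero} () | no _
select⁻ P? {suc x} (there x∈) = select⁻ (λ y → P? (suc y)) x∈

triple : ∀ {n} → Fin n → Fin n → Fin n → Subset n
triple a b c = ⁅ a ⁆ ∪ ⁅ b ⁆ ∪ ⁅ c ⁆

record IsTriple {n} (T : Subset n) (a b c : Fin n) : Set where
  field
    members : ∀ {x} → x ∈ T → x ≡ a ⊎ x ≡ b ⊎ x ≡ c
    a∈T     : a ∈ T
    b∈T     : b ∈ T
    c∈T     : c ∈ T

triple-is-triple : ∀ {n} {a b c : Fin n} → IsTriple (triple a b c) a b c
triple-is-triple {a = a} {b} {c} = record
  { members = members
  ; a∈T = p⊆p∪q (⁅ b ⁆ ∪ ⁅ c ⁆) (x∈⁅x⁆ a)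
  ; b∈T = q⊆p∪q ⁅ a ⁆ _ (p⊆p∪q ⁅ c ⁆ (x∈⁅x⁆ b))
  ; c∈T = q⊆p∪q ⁅ a ⁆ _ (q⊆p∪q ⁅ b ⁆ ⁅ c ⁆ (x∈⁅x⁆ c))
  }
  where
  members : ∀ {x} → x ∈ triple a b c → x ≡ a ⊎ x ≡ b ⊎ x ≡ c
  members x∈ with x∈p∪q⁻ ⁅ a ⁆ (⁅ b ⁆ ∪ ⁅ c ⁆) x∈
  ... | inj₁ x∈a = inj₁ (x∈⁅y⁆⇒x≡y a x∈a)
  ... | inj₂ x∈bc with x∈p∪q⁻ ⁅ b ⁆ ⁅ c ⁆ x∈bc
  ...   | inj₁ x∈b = inj₂ (inj₁ (x∈⁅y⁆⇒x≡y b x∈b))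
  ...   | inj₂ x∈c = inj₂ (inj₂ (x∈⁅y⁆⇒x≡y c x∈c))

reverse-triple : ∀ {n} {T : Subset n} {a b c} → IsTriple T a b c → IsTriple T c b a
reverse-triple t = record
  { members = λ x∈ → reorder (members x∈) ; a∈T = c∈T ; b∈T = b∈T ; c∈T = a∈T }
  where
  open IsTriple t
  reorder : ∀ {A B C : Set} → A ⊎ B ⊎ C → C ⊎ B ⊎ A
  reorder (inj₁ x) = inj₂ (inj₂ x)
  reorder (inj₂ (inj₁ x)) = inj₂ (inj₁ x)
  reorder (inj₂ (inj₂ x)) = inj₁ x

∉triple : ∀ {n} {a b c x : Fin n} → x ≢ a → x ≢ b → x ≢ c → x ∉ triple a b c
∉triple x≢a x≢b x≢c x∈ with IsTriple.members triple-is-triple x∈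
... | inj₁ x≡a = x≢a x≡a
... | inj₂ (inj₁ x≡b) = x≢b x≡b
... | inj₂ (inj₂ x≡c) = x≢c x≡c

module Walks {n : ℕ} (G : SimpleGraph n) where

  reach-source : ∀ {W u w} → Reach G W u w → u ∈ W
  reach-source (here u∈) = u∈
  reach-source (there u∈ _ _) = u∈

  reach-target : ∀ {W u w} → Reach G W u w → w ∈ W
  reach-target (here u∈) = u∈
  reach-target (there _ _ r) = reach-target r

  reach-mono : ∀ {W W'} → W ⊆ W' → ∀ {u w} → Reach G W u w → Reach G W' u w
  reach-mono W⊆ (here u∈) = here (W⊆ u∈)
  reach-mono W⊆ (there u∈ uu' r) = there (W⊆ u∈) uu' (reach-mono W⊆ r)

  reach-trans : ∀ {W u w x} → Reach G W u w → Reach G W w x → Reach G W u x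
  reach-trans (here _) r' = r'
  reach-trans (there u∈ uu' r) r' = there u∈ uu' (reach-trans r r')

  reach-edge : ∀ {W u w} → u ∈ W → w ∈ W → Adj G u w → Reach G W u w
  reach-edge u∈ w∈ uw = there u∈ uw (here w∈)

  reach-snoc : ∀ {W u w x} → Reach G W u w → Adj G w x → x ∈ W → Reach G W u x
  reach-snoc r wx x∈ = reach-trans r (reach-edge (reach-target r) x∈ wx)

  reach-sym : ∀ {W u w} → Reach G W u w → Reach G W w u
  reach-sym (here u∈) = here u∈
  reach-sym (there u∈ uu' r) = reach-snoc (reach-sym r) (sym G uu') u∈

  component-closed : ∀ {W X} → Component G W X →
                     ∀ {u w} → u ∈ X → w ∈ W → Adj G u w → w ∈ X
  component-closed (_ , _ , _ , closed) = closed

  component-reach-closed : ∀ {W X} → Component G W X →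
                           ∀ {u w} → Reach G W u w → u ∈ X → w ∈ X
  component-reach-closed X-comp (here _) u∈X = u∈X
  component-reach-closed X-comp (there _ uu' r) u∈X =
    component-reach-closed X-comp r (component-closed X-comp u∈X (reach-source r) uu')

  component-connected : ∀ {W X} → Component G W X → Connected G X
  component-connected (_ , _ , X-conn , _) = X-conn

  trapped-in-component : ∀ {W X B} → Component G W X → Connected G B → B ⊆ W →
                         ∀ {x} → x ∈ B → x ∈ X → B ⊆ X
  trapped-in-component X-comp B-conn B⊆W x∈B x∈X y∈B =
    component-reach-closed X-comp (reach-mono B⊆W (B-conn x∈B y∈B)) x∈X

  leaving-edge : ∀ {W Y u w} → Reach G W u w → u ∈ Y → w ∉ Y →
                 ∃ λ p → ∃ λ q → p ∈ Y × q ∉ Y × q ∈ W × Adj G p q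
  leaving-edge (here _) u∈Y w∉Y = ⊥-elim (w∉Y u∈Y)
  leaving-edge {Y = Y} (there {w = u'} _ uu' r) u∈Y w∉Y with u' ∈? Y
  ... | yes u'∈Y = leaving-edge r u'∈Y w∉Y
  ... | no u'∉Y = _ , _ , u∈Y , u'∉Y , reach-source r , uu'

  split-at : ∀ {W x w} u → Reach G W x w →
             Reach G (W - u) x w ⊎ u ≡ w ⊎
             ∃ λ u' → u' ∈ W - u × Adj G u u' × Reach G (W - u) u' w
  split-at {x = x} u (here x∈) with x ≟F u
  ... | yes refl = inj₂ (inj₁ refl)
  ... | no x≢u = inj₁ (here (x∈p∧x≢y⇒x∈p-y x∈ x≢u))
  split-at {x = x} u (there {w = y} x∈ xy r) with split-at u r
  ... | inj₂ ends-or-restarts = inj₂ ends-or-restarts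
  ... | inj₁ r' with x ≟F u
  ...   | yes refl = inj₂ (inj₂ (y , reach-source r' , xy , r'))
  ...   | no x≢u = inj₁ (there (x∈p∧x≢y⇒x∈p-y x∈ x≢u) xy r')

module Components {n : ℕ} (G : SimpleGraph n) where
  open Walks G

  -- Decided by induction on |W|: either u = w, or some neighbour of u
  -- reaches w inside W - u.
  reach-dec-bounded : ∀ f W → ∣ W ∣ < f → ∀ u w → Dec (Reach G W u w)
  reach-dec-bounded ℕ.zero W () u w
  reach-dec-bounded (ℕ.suc f) W ∣W∣<f u w with u ∈? W
  ... | no u∉ = no (λ r → u∉ (reach-source r))
  ... | yes u∈ with u ≟F w
  ...   | yes refl = yes (here u∈)
  ...   | no u≢w with any? (λ u' → (u' ∈? W - u) ×-dec (dec G u u' ×-dec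
                      reach-dec-bounded f (W - u) ∣W-u∣<f u' w))
    where ∣W-u∣<f = <-≤-trans (x∈p⇒∣p-x∣<∣p∣ u∈) (≤-pred ∣W∣<f)
  ...     | yes (u' , u'∈ , uu' , r) = yes (there u∈ uu' (reach-mono (p─q⊆p W ⁅ u ⁆) r))
  ...     | no no-neighbour = no λ r → impossible (split-at u r)
    where
    impossible : _ → False
    impossible (inj₁ r') = ∈─⇒∉ (reach-source r') (x∈⁅x⁆ u)
    impossible (inj₂ (inj₁ u≡w)) = u≢w u≡w
    impossible (inj₂ (inj₂ step)) = no-neighbour step

  reach? : ∀ W u w → Dec (Reach G W u w)
  reach? W = reach-dec-bounded (ℕ.suc n) W (s≤s (∣p∣≤n W))

  componentOf : Subset n → Fin n → Subset n
  componentOf W u = select (reach? W u)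

  ∈componentOf⁺ : ∀ {W u w} → Reach G W u w → w ∈ componentOf W u
  ∈componentOf⁺ {W} {u} = select⁺ (reach? W u)

  ∈componentOf⁻ : ∀ {W u w} → w ∈ componentOf W u → Reach G W u w
  ∈componentOf⁻ {W} {u} = select⁻ (reach? W u)

  reach-in-componentOf : ∀ {W u x y} → Reach G W u x → Reach G W x y →
                         Reach G (componentOf W u) x y
  reach-in-componentOf ux (here _) = here (∈componentOf⁺ ux)
  reach-in-componentOf ux (there _ xx' r) =
    there (∈componentOf⁺ ux) xx' (reach-in-componentOf (reach-snoc ux xx' (reach-source r)) r)

  componentOf-component : ∀ {W u} → u ∈ W → Component G W (componentOf W u)
  componentOf-component {W} {u} u∈ =
    (λ w∈ → reach-target (∈componentOf⁻ w∈)) ,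
    (u , ∈componentOf⁺ (here u∈)) ,
    (λ x∈ y∈ → reach-trans (reach-sym (reach-in-componentOf (here u∈) (∈componentOf⁻ x∈)))
                           (reach-in-componentOf (here u∈) (∈componentOf⁻ y∈))) ,
    (λ x∈ w∈ xw → ∈componentOf⁺ (reach-snoc (∈componentOf⁻ x∈) xw w∈))

  u∈componentOf : ∀ {W u} → u ∈ W → u ∈ componentOf W u
  u∈componentOf u∈ = ∈componentOf⁺ (here u∈)

  same-componentOf : ∀ {W w x p} → p ∈ componentOf W w → p ∈ componentOf W x →
                     w ∈ componentOf W x
  same-componentOf p∈w p∈x =
    ∈componentOf⁺ (reach-trans (∈componentOf⁻ p∈x) (reach-sym (∈componentOf⁻ p∈w)))

module Separators {n : ℕ} (G : SimpleGraph n) where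
  open Walks G

  separator∉component : ∀ {A X v} → Component G (A - v) X → v ∉ X
  separator∉component (X⊆ , _) v∈X = ∈─⇒∉ (X⊆ v∈X) (x∈⁅x⁆ _)

  -- A walk in G[A] ending outside X can be rerouted to avoid X: from its own
  -- start if that is outside X, and from v otherwise (it enters X through v).
  walk-around-component :
    ∀ {A X v} → Component G (A - v) X → ∀ {x y} → Reach G A x y → y ∉ X →
    (x ∉ X → Reach G (A ─ X) x y) × (x ∈ X → Reach G (A ─ X) v y)
  walk-around-component X-comp (here y∈) y∉X =
    (λ x∉X → here (x∈p∧x∉q⇒x∈p─q y∈ x∉X)) , (λ x∈X → ⊥-elim (y∉X x∈X))
  walk-around-component {X = X} {v} X-comp {x} (there {w = w} x∈ xw r) y∉X
    with walk-around-component X-comp r y∉X | w ∈? X | x ∈? X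
  ... | _ , from-v | yes w∈X | yes x∈X = (λ x∉X → ⊥-elim (x∉X x∈X)) , (λ _ → from-v w∈X)
  ... | from-w , _ | no w∉X | no x∉X =
    (λ _ → there (x∈p∧x∉q⇒x∈p─q x∈ x∉X) xw (from-w w∉X)) , (λ x∈X → ⊥-elim (x∉X x∈X))
  ... | _ , from-v | yes w∈X | no x∉X with x ≟F v
  ...   | yes refl = (λ _ → from-v w∈X) , (λ x∈X → ⊥-elim (x∉X x∈X))
  ...   | no x≢v =
    ⊥-elim (x∉X (component-closed X-comp w∈X (x∈p∧x≢y⇒x∈p-y x∈ x≢v) (sym G xw)))
  walk-around-component {X = X} {v} X-comp {x} (there {w = w} x∈ xw r) y∉X
    | from-w , _ | no w∉X | yes x∈X with w ≟F v
  ...   | yes refl = (λ x∉X → ⊥-elim (x∉X x∈X)) , (λ _ → from-w w∉X)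
  ...   | no w≢v =
    ⊥-elim (w∉X (component-closed X-comp x∈X (x∈p∧x≢y⇒x∈p-y (reach-source r) w≢v) xw))

  connected-minus-component : ∀ {A X v} → Connected G A → v ∈ A →
                              Component G (A - v) X → Connected G (A ─ X)
  connected-minus-component {A} {X} {v} A-conn v∈ X-comp u∈ w∈ =
    reach-trans (to-v u∈) (reach-sym (to-v w∈))
    where
    to-v : ∀ {u} → u ∈ A ─ X → Reach G (A ─ X) u v
    to-v u∈ = proj₁ (walk-around-component X-comp (A-conn (∈─⇒∈ u∈) v∈)
                                            (separator∉component X-comp)) (∈─⇒∉ u∈)

  -- A 2-connected B ⊆ A meeting the component X of G[A] - v lies in X ∪ {v}:
  -- B - v is connected and avoids v, so it is trapped in X.
  two-connected-in-component : ∀ {A X v B} → Component G (A - v) X → TwoConnected G B →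
                               B ⊆ A → ∀ {x} → x ∈ B → x ∈ X → B ⊆ X ∪ ⁅ v ⁆
  two-connected-in-component {A} {X} {v} {B} X-comp (_ , B-conn , B-v-conn) B⊆A {x} x∈B x∈X {y} y∈B
    with y ≟F v | v ∈? B
  ... | yes refl | _ = q⊆p∪q X ⁅ v ⁆ (x∈⁅x⁆ v)
  ... | no y≢v | yes v∈B =
    p⊆p∪q ⁅ v ⁆ (trapped-in-component X-comp (B-v-conn v∈B) B-v⊆A-v
                   (x∈p∧x≢y⇒x∈p-y x∈B x≢v) x∈X (x∈p∧x≢y⇒x∈p-y y∈B y≢v))
    where
    x≢v : x ≢ v
    x≢v refl = separator∉component X-comp x∈X
    B-v⊆A-v : B - v ⊆ A - v
    B-v⊆A-v z∈ = x∈p∧x∉q⇒x∈p─q (B⊆A (∈─⇒∈ z∈)) (∈─⇒∉ z∈)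
  ... | no y≢v | no v∉B = p⊆p∪q ⁅ v ⁆ (trapped-in-component X-comp B-conn B⊆A-v x∈B x∈X y∈B)
    where
    B⊆A-v : B ⊆ A - v
    B⊆A-v z∈ = x∈p∧x∉q⇒x∈p─q (B⊆A z∈) λ z∈v → v∉B (subst (_∈ B) (x∈⁅y⁆⇒x≡y v z∈v) z∈)

module Cliques {n : ℕ} (G : SimpleGraph n) where
  open Walks G

  adj⇒≢ : ∀ {x y} → Adj G x y → x ≢ y
  adj⇒≢ xy refl = irrefl G xy

  clique-mono : ∀ {X Y} → Clique G X → Y ⊆ X → Clique G Y
  clique-mono X-clique Y⊆X u∈ w∈ = X-clique (Y⊆X u∈) (Y⊆X w∈)

  clique-extend : ∀ {Y x} → Clique G Y → (∀ {y} → y ∈ Y → y ≢ x → Adj G x y) →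
                  Clique G (Y ∪ ⁅ x ⁆)
  clique-extend {Y} {x} Y-clique x-adj {u} {w} u∈ w∈ u≢w
    with x∈p∪q⁻ Y ⁅ x ⁆ u∈ | x∈p∪q⁻ Y ⁅ x ⁆ w∈
  ... | inj₁ u∈Y | inj₁ w∈Y = Y-clique u∈Y w∈Y u≢w
  ... | inj₁ u∈Y | inj₂ w∈x with x∈⁅y⁆⇒x≡y x w∈x
  ...   | refl = sym G (x-adj u∈Y u≢w)
  clique-extend {Y} {x} Y-clique x-adj {u} {w} u∈ w∈ u≢w
      | inj₂ u∈x | inj₁ w∈Y with x∈⁅y⁆⇒x≡y x u∈x
  ...   | refl = x-adj w∈Y (≢-sym u≢w)
  clique-extend {Y} {x} Y-clique x-adj {u} {w} u∈ w∈ u≢w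
      | inj₂ u∈x | inj₂ w∈x =
    ⊥-elim (u≢w (trans (x∈⁅y⁆⇒x≡y x u∈x) (≡-sym (x∈⁅y⁆⇒x≡y x w∈x))))

  star-connected : ∀ {Y c} → c ∈ Y → (∀ {w} → w ∈ Y → w ≡ c ⊎ Adj G w c) → Connected G Y
  star-connected {Y} {c} c∈ spoke u∈ w∈ = reach-trans (to-centre u∈) (reach-sym (to-centre w∈))
    where
    to-centre : ∀ {w} → w ∈ Y → Reach G Y w c
    to-centre w∈ with spoke w∈
    ... | inj₁ refl = here c∈
    ... | inj₂ wc = reach-edge w∈ c∈ wc

  record InducedP3 (Y : Subset n) (a b c : Fin n) : Set where
    constructor induced-P3
    field
      a∈ : a ∈ Y
      b∈ : b ∈ Y
      c∈ : c ∈ Y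
      ab : Adj G a b
      bc : Adj G b c
      ¬ac : ¬ Adj G a c
      a≢c : a ≢ c

  reverse-P3 : ∀ {Y a b c} → InducedP3 Y a b c → InducedP3 Y c b a
  reverse-P3 (induced-P3 a∈ b∈ c∈ ab bc ¬ac a≢c) =
    induced-P3 c∈ b∈ a∈ (sym G bc) (sym G ab) (λ ca → ¬ac (sym G ca)) (≢-sym a≢c)

  P3-mono : ∀ {Y Y' a b c} → Y ⊆ Y' → InducedP3 Y a b c → InducedP3 Y' a b c
  P3-mono Y⊆ (induced-P3 a∈ b∈ c∈ ab bc ¬ac a≢c) = induced-P3 (Y⊆ a∈) (Y⊆ b∈) (Y⊆ c∈) ab bc ¬ac a≢c

  -- A walk in G[Y] between distinct non-adjacent vertices contains an induced
  -- path: follow it until the first vertex that sees the endpoint.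
  walk-has-P3 : ∀ {Y x y} → Reach G Y x y → x ≢ y → ¬ Adj G x y →
                ∃ λ a → ∃ λ b → ∃ λ c → InducedP3 Y a b c
  walk-has-P3 (here _) x≢y _ = ⊥-elim (x≢y refl)
  walk-has-P3 {y = y} (there {u = x} {w = w} x∈ xw r) x≢y ¬xy with w ≟F y
  ... | yes refl = ⊥-elim (¬xy xw)
  ... | no w≢y with dec G w y
  ...   | yes wy = x , w , y , induced-P3 x∈ (reach-source r) (reach-target r) xw wy ¬xy x≢y
  ...   | no ¬wy = walk-has-P3 r w≢y ¬wy

  P3-free⇒clique : ∀ {Y} → Connected G Y →
                   (∀ {a b c} → InducedP3 Y a b c → False) → Clique G Y
  P3-free⇒clique Y-conn P3-free {u} {w} u∈ w∈ u≢w with dec G u w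
  ... | yes uw = uw
  ... | no ¬uw with walk-has-P3 (Y-conn u∈ w∈) u≢w ¬uw
  ...   | _ , _ , _ , P = ⊥-elim (P3-free P)

  Attached : Subset n → Fin n → Set
  Attached Y t = ∃ λ y → y ∈ Y × Adj G y t

  attached? : ∀ Y t → Dec (Attached Y t)
  attached? Y t = any? (λ y → (y ∈? Y) ×-dec dec G y t)

module Invariant {n : ℕ} (G : SimpleGraph n) where
  open Walks G
  open Separators G
  open Cliques G

  Invariant : State G → Set
  Invariant ⟨ A , M , _ ⟩ =
    Connected G A × (∀ B → TwoConnected G B → B ⊆ ∁ M → ¬ Clique G B → B ⊆ A)

  -- Rule 4 leaves exactly the component Y, which is connected.
  rule4-remainder-connected :
    ∀ {A x y X Y} → Component G (A ─ (⁅ x ⁆ ∪ ⁅ y ⁆)) Y → Empty (X ∩ Y) →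
    (A ─ (⁅ x ⁆ ∪ ⁅ y ⁆)) ⊆ X ∪ Y → Connected G (A ─ ((⁅ x ⁆ ∪ ⁅ y ⁆) ∪ X))
  rule4-remainder-connected {A} {x} {y} {X} {Y} Y-comp X∩Y-empty covered u∈ w∈ =
    reach-mono Y⊆rest (component-connected Y-comp (rest⊆Y u∈) (rest⊆Y w∈))
    where
    xy : Subset n
    xy = ⁅ x ⁆ ∪ ⁅ y ⁆
    rest⊆Y : ∀ {z} → z ∈ A ─ (xy ∪ X) → z ∈ Y
    rest⊆Y z∈ with x∈p∪q⁻ X Y (covered (∈─⇒∈─ z∈ (λ z∈xy → ∈─⇒∉ z∈ (p⊆p∪q X z∈xy))))
    ... | inj₁ z∈X = ⊥-elim (∈─⇒∉ z∈ (q⊆p∪q xy X z∈X))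
    ... | inj₂ z∈Y = z∈Y
    Y⊆rest : Y ⊆ A ─ (xy ∪ X)
    Y⊆rest {z} z∈Y = x∈p∧x∉q⇒x∈p─q (∈─⇒∈ (proj₁ Y-comp z∈Y)) not-deleted
      where
      not-deleted : z ∉ xy ∪ X
      not-deleted z∈ with x∈p∪q⁻ xy X z∈
      ... | inj₁ z∈xy = ∈─⇒∉ (proj₁ Y-comp z∈Y) z∈xy
      ... | inj₂ z∈X = X∩Y-empty (z , x∈p∩q⁺ (z∈X , z∈Y))

  step-preserves-invariant : ∀ {s s'} → Step G s s' → Invariant s → Invariant s'
  step-preserves-invariant (rule1 (v∈ , X-comp , Xv-clique)) (A-conn , kept) =
    connected-minus-component A-conn v∈ X-comp ,
    λ B B-2conn B-unmarked B-nonclique {x} x∈B →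
      let B⊆A = kept B B-2conn B-unmarked B-nonclique in
      x∈p∧x∉q⇒x∈p─q (B⊆A x∈B) λ x∈X →
        B-nonclique (clique-mono Xv-clique (two-connected-in-component X-comp B-2conn B⊆A x∈B x∈X))
  step-preserves-invariant (rule2 {A} {v = v} _ v∈ X-comp X-clique) (A-conn , kept) =
    connected-minus-component A-conn v∈ X-comp ,
    λ B B-2conn B-unmarked B-nonclique {x} x∈B →
      let B⊆A = kept B B-2conn (λ b∈ → ∈∁∪⇒∈∁ (B-unmarked b∈)) B-nonclique
          B⊆A-v : B ⊆ A - v
          B⊆A-v b∈ = x∈p∧x∉q⇒x∈p─q (B⊆A b∈) (∈∁∪⇒∉ (B-unmarked b∈))
      in x∈p∧x∉q⇒x∈p─q (B⊆A x∈B) λ x∈X →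
           B-nonclique (clique-mono X-clique
             (trapped-in-component X-comp (proj₁ (proj₂ B-2conn)) B⊆A-v x∈B x∈X))
  step-preserves-invariant (rule3 _ _ _ _ _ _ _ rest-conn) (_ , kept) =
    rest-conn , λ B B-2conn B-unmarked B-nonclique {x} x∈B →
      x∈p∧x∉q⇒x∈p─q (kept B B-2conn (λ b∈ → ∈∁∪⇒∈∁ (B-unmarked b∈)) B-nonclique x∈B)
                    (∈∁∪⇒∉ (B-unmarked x∈B))
  step-preserves-invariant
    (rule4 {A} {x = x} {y} {X} _ _ _ _ X-comp Y-comp X∩Y-empty covered Xx-clique _) (_ , kept) =
    rule4-remainder-connected Y-comp X∩Y-empty covered ,
    λ B B-2conn B-unmarked B-nonclique {z} z∈B →
      let B⊆A = kept B B-2conn (λ b∈ → ∈∁∪⇒∈∁ (B-unmarked b∈)) B-nonclique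
          B⊆A-xy : B ⊆ A ─ (⁅ x ⁆ ∪ ⁅ y ⁆)
          B⊆A-xy b∈ = x∈p∧x∉q⇒x∈p─q (B⊆A b∈) (∈∁∪⇒∉ (B-unmarked b∈))
          outside-X : z ∉ X
          outside-X z∈X = B-nonclique (clique-mono Xx-clique (λ b∈ → p⊆p∪q ⁅ x ⁆
            (trapped-in-component X-comp (proj₁ (proj₂ B-2conn)) B⊆A-xy z∈B z∈X b∈)))
      in x∈p∧x∉q⇒x∈p─q (B⊆A z∈B) λ z∈ → [ ∈∁∪⇒∉ (B-unmarked z∈B) , outside-X ]′
                                            (x∈p∪q⁻ (⁅ x ⁆ ∪ ⁅ y ⁆) X z∈)

  steps-preserve-invariant : ∀ {s s'} → Steps G s s' → Invariant s → Invariant s'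
  steps-preserve-invariant ε inv = inv
  steps-preserve-invariant (step ◅ steps) inv =
    steps-preserve-invariant steps (step-preserves-invariant step inv)

module Exhaustion {n : ℕ} (G : SimpleGraph n) {A M : Subset n} {k : ℤ}
                  (A-conn : Connected G A) (exhausted : Exhausted G ⟨ A , M , k ⟩) where
  open Walks G
  open Components G
  open Separators G
  open Cliques G

  no-rule1 : ¬ (∃ λ v → ∃ λ X → Rule1Applies G A v X)
  no-rule1 (_ , _ , applies) = exhausted _ (rule1 applies)

  module MinimalComponent (v : Fin n) (v∈A : v ∈ A) (X : Subset n) (X-comp : Component G (A - v) X)
    (X-minimal : ∀ {v' X'} → v' ∈ A → Component G (A - v') X' → ∣ X' ∣ < ∣ X ∣ → False) where

    X⊆A : X ⊆ A
    X⊆A x∈ = ∈─⇒∈ (proj₁ X-comp x∈)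

    v∉X : v ∉ X
    v∉X = separator∉component X-comp

    -- Cutting G[A] at s ∈ X, every component contains v: a component
    -- missing v would lie in X - s and be smaller than X.
    cut-components-contain-v : ∀ {s W} → s ∈ X → Component G (A - s) W → v ∈ W
    cut-components-contain-v {s} {W} s∈X W-comp with v ∈? W
    ... | yes v∈W = v∈W
    ... | no v∉W = ⊥-elim (X-minimal (X⊆A s∈X) W-comp
                              (≤-<-trans (p⊆q⇒∣p∣≤∣q∣ W⊆X-s) (x∈p⇒∣p-x∣<∣p∣ s∈X)))
      where
      A-X⊆A-s : A ─ X ⊆ A - s
      A-X⊆A-s w∈ = x∈p∧x≢y⇒x∈p-y (∈─⇒∈ w∈) λ { refl → ∈─⇒∉ w∈ s∈X }
      W⊆X-s : W ⊆ X - s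
      W⊆X-s {w} w∈W with w ∈? X
      ... | yes w∈X = x∈p∧x∉q⇒x∈p─q w∈X (∈─⇒∉ (proj₁ W-comp w∈W))
      ... | no w∉X = ⊥-elim (v∉W (component-reach-closed W-comp (reach-mono A-X⊆A-s w⇝v) w∈W))
        where
        w⇝v : Reach G (A ─ X) w v
        w⇝v = proj₁ (walk-around-component X-comp (A-conn (∈─⇒∈ (proj₁ W-comp w∈W)) v∈A) v∉X)
                    w∉X

    K : Subset n → Subset n
    K T = componentOf (A ─ T) v

    Maximal : Subset n → Set
    Maximal T = ∀ {x y w} → InducedP3 X x y w → ∣ K T ∣ < ∣ K (triple x y w) ∣ → False

    module Stray {T a b c} (T-is : IsTriple T a b c) (P : InducedP3 X a b c)
                 (maximal : Maximal T) {z} (z∈ : z ∈ A ─ T) (z∉K : z ∉ K T) where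
      open IsTriple T-is
      open InducedP3 P

      T⊆X : T ⊆ X
      T⊆X t∈ with members t∈
      ... | inj₁ refl = a∈
      ... | inj₂ (inj₁ refl) = b∈
      ... | inj₂ (inj₂ refl) = c∈

      T≢ : ∀ {s w} → s ∈ T → w ∈ A ─ T → s ≢ w
      T≢ s∈T w∈ refl = ∈─⇒∉ w∈ s∈T

      v∈A-T : v ∈ A ─ T
      v∈A-T = x∈p∧x∉q⇒x∈p─q v∈A (λ v∈T → v∉X (T⊆X v∈T))

      K-comp : Component G (A ─ T) (K T)
      K-comp = componentOf-component v∈A-T

      v∈K : v ∈ K T
      v∈K = u∈componentOf v∈A-T

      T∉K : ∀ {s} → s ∈ T → s ∉ K T
      T∉K s∈T s∈K = ∈─⇒∉ (proj₁ K-comp s∈K) s∈T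

      -- Vertices of G[A] - T outside K lie in X: from outside X, the vertex v
      -- is reachable while avoiding X ⊇ T.
      outside-K⇒∈X : ∀ {w} → w ∈ A ─ T → w ∉ K T → w ∈ X
      outside-K⇒∈X {w} w∈ w∉K with w ∈? X
      ... | yes w∈X = w∈X
      ... | no w∉X = ⊥-elim (w∉K (∈componentOf⁺ (reach-sym (reach-mono A-X⊆A-T w⇝v))))
        where
        A-X⊆A-T : A ─ X ⊆ A ─ T
        A-X⊆A-T u∈ = ∈─⇒∈─ u∈ (λ u∈T → ∈─⇒∉ u∈ (T⊆X u∈T))
        w⇝v : Reach G (A ─ X) w v
        w⇝v = proj₁ (walk-around-component X-comp (A-conn (∈─⇒∈ w∈) v∈A) v∉X) w∉X

      -- If an induced path x–y–w of X avoids K and another vertex t of T is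
      -- attached to K, then deleting {x, y, w} instead of T enlarges K by t.
      K-cannot-grow : ∀ {x y w t} → InducedP3 X x y w → x ∉ K T → y ∉ K T → w ∉ K T →
                      t ∈ T → t ≢ x → t ≢ y → t ≢ w → Attached (K T) t → False
      K-cannot-grow {x} {y} {w} {t} P' x∉K y∉K w∉K t∈T t≢x t≢y t≢w (u , u∈K , ut) =
        maximal P' (p⊂q⇒∣p∣<∣q∣ (K⊆K' , t , t∈K' , T∉K t∈T))
        where
        T' : Subset n
        T' = triple x y w
        K⊆A-T' : K T ⊆ A ─ T'
        K⊆A-T' {q} q∈K = x∈p∧x∉q⇒x∈p─q (∈─⇒∈ (proj₁ K-comp q∈K))
          (∉triple (λ { refl → x∉K q∈K }) (λ { refl → y∉K q∈K }) (λ { refl → w∉K q∈K }))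
        v⇝ : ∀ {q} → q ∈ K T → Reach G (A ─ T') v q
        v⇝ q∈K = reach-mono K⊆A-T' (component-connected K-comp v∈K q∈K)
        K⊆K' : K T ⊆ K T'
        K⊆K' q∈K = ∈componentOf⁺ (v⇝ q∈K)
        t∈K' : t ∈ K T'
        t∈K' = ∈componentOf⁺ (reach-snoc (v⇝ u∈K) ut
                 (x∈p∧x∉q⇒x∈p─q (X⊆A (T⊆X t∈T)) (∉triple t≢x t≢y t≢w)))

      Z : Subset n
      Z = componentOf (A ─ T) z

      Z-comp : Component G (A ─ T) Z
      Z-comp = componentOf-component z∈

      Z⊆A-T : Z ⊆ A ─ T
      Z⊆A-T = proj₁ Z-comp

      Z∉K : ∀ {w} → w ∈ Z → w ∉ K T
      Z∉K w∈Z w∈K = z∉K (same-componentOf w∈Z w∈K)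

      Z⊆X : Z ⊆ X
      Z⊆X w∈Z = outside-K⇒∈X (Z⊆A-T w∈Z) (Z∉K w∈Z)

      v∉Z : v ∉ Z
      v∉Z v∈Z = Z∉K v∈Z v∈K

      -- By minimality of X, every vertex of A - T reaches v avoiding any s ∈ T.
      reaches-v-avoiding : ∀ {s w} → s ∈ T → w ∈ A ─ T → Reach G (A - s) w v
      reaches-v-avoiding s∈T w∈ = ∈componentOf⁻ (cut-components-contain-v (T⊆X s∈T)
        (componentOf-component (x∈p∧x≢y⇒x∈p-y (∈─⇒∈ w∈) (≢-sym (T≢ s∈T w∈)))))

      attached-elsewhere : ∀ {Y s y y'} → Component G (A ─ T) Y → s ∈ T →
                           Reach G (A - s) y y' → y ∈ Y → y' ∉ Y →
                           ∃ λ t → t ∈ T × t ≢ s × Attached Y t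
      attached-elsewhere Y-comp s∈T r y∈Y y'∉Y with leaving-edge r y∈Y y'∉Y
      ... | p , q , p∈Y , q∉Y , q∈A-s , pq with q ∈? T
      ...   | yes q∈T = q , q∈T , (λ { refl → ∈─⇒∉ q∈A-s (x∈⁅x⁆ _) }) , p , p∈Y , pq
      ...   | no q∉T = ⊥-elim (q∉Y (component-closed Y-comp p∈Y (∈─⇒∈─ q∈A-s q∉T) pq))

      Z-attached-elsewhere : ∀ {s} → s ∈ T → ∃ λ t → t ∈ T × t ≢ s × Attached Z t
      Z-attached-elsewhere s∈T =
        attached-elsewhere Z-comp s∈T (reaches-v-avoiding s∈T z∈) (u∈componentOf z∈) v∉Z

      K-attached-elsewhere : ∀ {s} → s ∈ T → ∃ λ t → t ∈ T × t ≢ s × Attached (K T) t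
      K-attached-elsewhere s∈T =
        attached-elsewhere K-comp s∈T (reach-sym (reaches-v-avoiding s∈T z∈)) v∈K z∉K

      -- Z is a clique: an induced path in Z avoids K, and K is attached to
      -- some vertex of T, so K could grow.
      Z-clique : Clique G Z
      Z-clique = P3-free⇒clique (component-connected Z-comp) no-P3
        where
        no-P3 : ∀ {x y w} → InducedP3 Z x y w → False
        no-P3 P'@(induced-P3 x∈ y∈ w∈ _ _ _ _) with K-attached-elsewhere a∈T
        ... | t , t∈T , _ , t-att =
          K-cannot-grow (P3-mono Z⊆X P') (Z∉K x∈) (Z∉K y∈) (Z∉K w∈) t∈T
            (T≢ t∈T (Z⊆A-T x∈)) (T≢ t∈T (Z⊆A-T y∈)) (T≢ t∈T (Z⊆A-T w∈)) t-att

      sees-all-of-Z : ∀ {s u w} → s ∈ T → u ∈ Z → w ∈ Z → Adj G s u → Adj G s w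
      sees-all-of-Z {s} {u} {w} s∈T u∈ w∈ su with u ≟F w
      ... | yes refl = su
      ... | no u≢w with dec G s w
      ...   | yes sw = sw
      ...   | no ¬sw with K-attached-elsewhere s∈T
      ...     | t , t∈T , t≢s , t-att = ⊥-elim (K-cannot-grow
                  (induced-P3 (T⊆X s∈T) (Z⊆X u∈) (Z⊆X w∈) su (Z-clique u∈ w∈ u≢w) ¬sw
                              (T≢ s∈T (Z⊆A-T w∈)))
                  (T∉K s∈T) (Z∉K u∈) (Z∉K w∈) t∈T t≢s (T≢ t∈T (Z⊆A-T u∈)) (T≢ t∈T (Z⊆A-T w∈))
                  t-att)

      -- Two non-adjacent vertices outside K with a common neighbour s ∈ T
      -- form an induced path of X, and K grows by a second vertex of T.
      no-common-T-neighbour : ∀ {p q s} → p ∈ A ─ T → q ∈ A ─ T → p ∉ K T → q ∉ K T →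
                              p ≢ q → ¬ Adj G p q → s ∈ T → Adj G s p → Adj G s q → False
      no-common-T-neighbour p∈ q∈ p∉K q∉K p≢q ¬pq s∈T sp sq with K-attached-elsewhere s∈T
      ... | t , t∈T , t≢s , t-att =
        K-cannot-grow (induced-P3 (outside-K⇒∈X p∈ p∉K) (T⊆X s∈T) (outside-K⇒∈X q∈ q∉K)
                                  (sym G sp) sq ¬pq p≢q)
                      p∉K (T∉K s∈T) q∉K t∈T (T≢ t∈T p∈) t≢s (T≢ t∈T q∈) t-att

      no-neighbour-beside-Z : ∀ {w s} → w ∈ A ─ T → w ∉ K T → w ∉ Z → s ∈ T → Adj G s w →
                              Attached Z s → False
      no-neighbour-beside-Z w∈ w∉K w∉Z s∈T sw (u , u∈Z , us) =
        no-common-T-neighbour w∈ (Z⊆A-T u∈Z) w∉K (Z∉K u∈Z) (λ { refl → w∉Z u∈Z })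
          (λ wu → w∉Z (component-closed Z-comp u∈Z w∈ (sym G wu))) s∈T sw (sym G us)

      -- ... so if all of T is attached to Z, then K and Z are the only
      -- components of G[A] - T (a third one is attached to T by minimality).
      only-K-and-Z : ∀ {w} → w ∈ A ─ T → w ∉ K T → w ∉ Z → (∀ {s} → s ∈ T → Attached Z s) → False
      only-K-and-Z {w} w∈ w∉K w∉Z all-attached
        with attached-elsewhere (componentOf-component w∈) a∈T (reaches-v-avoiding a∈T w∈)
                                (u∈componentOf w∈) (λ v∈W → w∉K (same-componentOf v∈W v∈K))
      ... | t , t∈T , _ , p , p∈W , pt =
        no-neighbour-beside-Z (proj₁ (componentOf-component w∈) p∈W)
          (λ p∈K → w∉K (same-componentOf p∈W p∈K)) (λ p∈Z → w∉Z (same-componentOf p∈W p∈Z))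
          t∈T (sym G pt) (all-attached t∈T)

      a≢b : a ≢ b
      a≢b = adj⇒≢ ab

      b≢c : b ≢ c
      b≢c = adj⇒≢ bc

      -- If a, b, c are all attached to Z but b is not attached to K, Rule 4
      -- applies with x = a, y = c and components Z ∪ {b} and K of G[A] - {a, c}.
      module Rule4Applies (a-att : Attached Z a) (b-att : Attached Z b) (c-att : Attached Z c)
                          (b-unattached-K : ¬ Attached (K T) b) where
        ac : Subset n
        ac = ⁅ a ⁆ ∪ ⁅ c ⁆

        Zb : Subset n
        Zb = Z ∪ ⁅ b ⁆

        ∈A-ac : ∀ {w} → w ∈ A → w ≢ a → w ≢ c → w ∈ A ─ ac
        ∈A-ac w∈ w≢a w≢c = x∈p∧x∉q⇒x∈p─q w∈ λ w∈ac →
          [ (λ w∈a → w≢a (x∈⁅y⁆⇒x≡y a w∈a)) , (λ w∈c → w≢c (x∈⁅y⁆⇒x≡y c w∈c)) ]′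
            (x∈p∪q⁻ ⁅ a ⁆ ⁅ c ⁆ w∈ac)

        A-T⊆A-ac : A ─ T ⊆ A ─ ac
        A-T⊆A-ac w∈ = ∈A-ac (∈─⇒∈ w∈) (≢-sym (T≢ a∈T w∈)) (≢-sym (T≢ c∈T w∈))

        T∩A-ac≡b : ∀ {w} → w ∈ T → w ∈ A ─ ac → w ≡ b
        T∩A-ac≡b w∈T w∈ with members w∈T
        ... | inj₁ refl = ⊥-elim (∈─⇒∉ w∈ (p⊆p∪q ⁅ c ⁆ (x∈⁅x⁆ a)))
        ... | inj₂ (inj₁ refl) = refl
        ... | inj₂ (inj₂ refl) = ⊥-elim (∈─⇒∉ w∈ (q⊆p∪q ⁅ a ⁆ ⁅ c ⁆ (x∈⁅x⁆ c)))

        b∈Zb : b ∈ Zb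
        b∈Zb = q⊆p∪q Z ⁅ b ⁆ (x∈⁅x⁆ b)

        all-attached : ∀ {s} → s ∈ T → Attached Z s
        all-attached s∈T with members s∈T
        ... | inj₁ refl = a-att
        ... | inj₂ (inj₁ refl) = b-att
        ... | inj₂ (inj₂ refl) = c-att

        Z-or-K : ∀ {w} → w ∈ A ─ T → w ∈ Z ⊎ w ∈ K T
        Z-or-K {w} w∈ with w ∈? Z | w ∈? K T
        ... | yes w∈Z | _ = inj₁ w∈Z
        ... | no _ | yes w∈K = inj₂ w∈K
        ... | no w∉Z | no w∉K = ⊥-elim (only-K-and-Z w∈ w∉K w∉Z all-attached)

        b-sees-Z : ∀ {u} → u ∈ Z → Adj G b u
        b-sees-Z u∈ = let (zb , zb∈ , zb-b) = b-att in sees-all-of-Z b∈T zb∈ u∈ (sym G zb-b)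

        -- Z ∪ {b} is a star around b, and an edge leaving it inside A - {a, c}
        -- would lead from b into K.
        Zb-comp : Component G (A ─ ac) Zb
        Zb-comp = Zb⊆ , (b , b∈Zb) , star-connected b∈Zb spoke , closed
          where
          Zb⊆ : Zb ⊆ A ─ ac
          Zb⊆ w∈ with x∈p∪q⁻ Z ⁅ b ⁆ w∈
          ... | inj₁ w∈Z = A-T⊆A-ac (Z⊆A-T w∈Z)
          ... | inj₂ w∈b with x∈⁅y⁆⇒x≡y b w∈b
          ...   | refl = ∈A-ac (X⊆A b∈) (≢-sym a≢b) b≢c
          spoke : ∀ {w} → w ∈ Zb → w ≡ b ⊎ Adj G w b
          spoke w∈ with x∈p∪q⁻ Z ⁅ b ⁆ w∈
          ... | inj₁ w∈Z = inj₂ (sym G (b-sees-Z w∈Z))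
          ... | inj₂ w∈b = inj₁ (x∈⁅y⁆⇒x≡y b w∈b)
          closed : ∀ {u w} → u ∈ Zb → w ∈ A ─ ac → Adj G u w → w ∈ Zb
          closed {u} {w} u∈ w∈ uw with w ∈? T
          ... | yes w∈T = subst (_∈ Zb) (≡-sym (T∩A-ac≡b w∈T w∈)) b∈Zb
          ... | no w∉T with Z-or-K (∈─⇒∈─ w∈ w∉T) | x∈p∪q⁻ Z ⁅ b ⁆ u∈
          ...   | inj₁ w∈Z | _ = p⊆p∪q ⁅ b ⁆ w∈Z
          ...   | inj₂ w∈K | inj₁ u∈Z = ⊥-elim (Z∉K (component-closed Z-comp u∈Z
                                          (∈─⇒∈─ w∈ w∉T) uw) w∈K)
          ...   | inj₂ w∈K | inj₂ u∈b with x∈⁅y⁆⇒x≡y b u∈b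
          ...     | refl = ⊥-elim (b-unattached-K (w , w∈K , sym G uw))

        -- K stays a component after adding b back, since b is not attached to K.
        K-comp-ac : Component G (A ─ ac) (K T)
        K-comp-ac = (λ w∈K → A-T⊆A-ac (proj₁ K-comp w∈K)) , (v , v∈K) ,
                    component-connected K-comp , closed
          where
          closed : ∀ {u w} → u ∈ K T → w ∈ A ─ ac → Adj G u w → w ∈ K T
          closed {u} {w} u∈K w∈ uw with w ∈? T
          ... | no w∉T = component-closed K-comp u∈K (∈─⇒∈─ w∈ w∉T) uw
          ... | yes w∈T with T∩A-ac≡b w∈T w∈
          ...   | refl = ⊥-elim (b-unattached-K (u , u∈K , uw))

        disjoint : Empty (Zb ∩ K T)
        disjoint (w , w∈) with x∈p∩q⁻ Zb (K T) w∈
        ... | w∈Zb , w∈K with x∈p∪q⁻ Z ⁅ b ⁆ w∈Zb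
        ...   | inj₁ w∈Z = Z∉K w∈Z w∈K
        ...   | inj₂ w∈b = T∉K b∈T (subst (_∈ K T) (x∈⁅y⁆⇒x≡y b w∈b) w∈K)

        covered : A ─ ac ⊆ Zb ∪ K T
        covered {w} w∈ with w ∈? T
        ... | yes w∈T = p⊆p∪q (K T) (subst (_∈ Zb) (≡-sym (T∩A-ac≡b w∈T w∈)) b∈Zb)
        ... | no w∉T = [ (λ w∈Z → p⊆p∪q (K T) (p⊆p∪q ⁅ b ⁆ w∈Z)) , q⊆p∪q Zb (K T) ]′
                         (Z-or-K (∈─⇒∈─ w∈ w∉T))

        Zb-clique : Clique G Zb
        Zb-clique = clique-extend Z-clique (λ u∈ _ → b-sees-Z u∈)

        Zb+end-clique : ∀ {s} → s ∈ T → Attached Z s → Adj G s b → Clique G (Zb ∪ ⁅ s ⁆)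
        Zb+end-clique {s} s∈T (zs , zs∈ , zs-s) sb = clique-extend Zb-clique s-sees
          where
          s-sees : ∀ {y} → y ∈ Zb → y ≢ s → Adj G s y
          s-sees y∈ _ with x∈p∪q⁻ Z ⁅ b ⁆ y∈
          ... | inj₁ y∈Z = sees-all-of-Z s∈T zs∈ y∈Z (sym G zs-s)
          ... | inj₂ y∈b with x∈⁅y⁆⇒x≡y b y∈b
          ...   | refl = sb

        applies : False
        applies = exhausted _ (rule4 (X⊆A a∈) (X⊆A c∈) a≢c ¬ac Zb-comp K-comp-ac disjoint covered
                                     (Zb+end-clique a∈T a-att ab) (Zb+end-clique c∈T c-att (sym G bc)))

      -- Both ends of the path attached to Z is impossible: according to
      -- whether b is attached to K or to Z, either K grows (by b, or by c
      -- via the path za–a–b) or Rule 4 applies.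
      both-ends-attached : Attached Z a → Attached Z c → False
      both-ends-attached a-att@(za , za∈ , za-a) c-att@(zc , zc∈ , zc-c) with attached? (K T) b
      ... | yes b-att-K =
        K-cannot-grow (induced-P3 a∈ (Z⊆X za∈) c∈ (sym G za-a)
                                  (sym G (sees-all-of-Z c∈T zc∈ za∈ (sym G zc-c))) ¬ac a≢c)
                      (T∉K a∈T) (Z∉K za∈) (T∉K c∈T) b∈T (≢-sym a≢b)
                      (T≢ b∈T (Z⊆A-T za∈)) b≢c b-att-K
      ... | no b-unattached-K with attached? Z b
      ...   | yes b-att = Rule4Applies.applies a-att b-att c-att b-unattached-K
      ...   | no b-unattached with K-attached-elsewhere a∈T
      ...     | t , t∈T , t≢a , t-att with members t∈T
      ...       | inj₁ refl = t≢a refl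
      ...       | inj₂ (inj₁ refl) = b-unattached-K t-att
      ...       | inj₂ (inj₂ refl) =
        K-cannot-grow (induced-P3 (Z⊆X za∈) a∈ b∈ za-a ab (λ za-b → b-unattached (za , za∈ , za-b))
                                  (≢-sym (T≢ b∈T (Z⊆A-T za∈))))
                      (Z∉K za∈) (T∉K a∈T) (T∉K b∈T) c∈T (T≢ c∈T (Z⊆A-T za∈))
                      (≢-sym a≢c) (≢-sym b≢c) t-att

      Za-cut-component : Attached Z a → ¬ Attached Z c → ¬ Attached (K T) a →
                         Component G (A - b) (Z ∪ ⁅ a ⁆)
      Za-cut-component a-att@(za , za∈ , za-a) c-unattached a-unattached-K =
        Za⊆ , (a , a∈Za) , star-connected a∈Za spoke , closed
        where
        a∈Za : a ∈ Z ∪ ⁅ a ⁆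
        a∈Za = q⊆p∪q Z ⁅ a ⁆ (x∈⁅x⁆ a)
        Za⊆ : Z ∪ ⁅ a ⁆ ⊆ A - b
        Za⊆ w∈ with x∈p∪q⁻ Z ⁅ a ⁆ w∈
        ... | inj₁ w∈Z = x∈p∧x≢y⇒x∈p-y (∈─⇒∈ (Z⊆A-T w∈Z)) (≢-sym (T≢ b∈T (Z⊆A-T w∈Z)))
        ... | inj₂ w∈a with x∈⁅y⁆⇒x≡y a w∈a
        ...   | refl = x∈p∧x≢y⇒x∈p-y (X⊆A a∈) a≢b
        spoke : ∀ {w} → w ∈ Z ∪ ⁅ a ⁆ → w ≡ a ⊎ Adj G w a
        spoke w∈ with x∈p∪q⁻ Z ⁅ a ⁆ w∈
        ... | inj₁ w∈Z = inj₂ (sym G (sees-all-of-Z a∈T za∈ w∈Z (sym G za-a)))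
        ... | inj₂ w∈a = inj₁ (x∈⁅y⁆⇒x≡y a w∈a)
        c-unreachable : ∀ {u} → u ∈ Z ⊎ u ∈ ⁅ a ⁆ → ¬ Adj G u c
        c-unreachable (inj₁ u∈Z) uc = c-unattached (_ , u∈Z , uc)
        c-unreachable (inj₂ u∈a) uc with x∈⁅y⁆⇒x≡y a u∈a
        ... | refl = ¬ac uc
        closed : ∀ {u w} → u ∈ Z ∪ ⁅ a ⁆ → w ∈ A - b → Adj G u w → w ∈ Z ∪ ⁅ a ⁆
        closed {u} {w} u∈ w∈ uw with w ∈? T | x∈p∪q⁻ Z ⁅ a ⁆ u∈
        ... | yes w∈T | u∈Z-or-a with members w∈T
        ...   | inj₁ refl = a∈Za
        ...   | inj₂ (inj₁ refl) = ⊥-elim (∈─⇒∉ w∈ (x∈⁅x⁆ b))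
        ...   | inj₂ (inj₂ refl) = ⊥-elim (c-unreachable u∈Z-or-a uw)
        closed {u} {w} u∈ w∈ uw | no w∉T | inj₁ u∈Z =
          p⊆p∪q ⁅ a ⁆ (component-closed Z-comp u∈Z (∈─⇒∈─ w∈ w∉T) uw)
        closed {u} {w} u∈ w∈ uw | no w∉T | inj₂ u∈a with x∈⁅y⁆⇒x≡y a u∈a | w ∈? Z | w ∈? K T
        ... | refl | yes w∈Z | _ = p⊆p∪q ⁅ a ⁆ w∈Z
        ... | refl | no _ | yes w∈K = ⊥-elim (a-unattached-K (w , w∈K , sym G uw))
        ... | refl | no w∉Z | no w∉K =
          ⊥-elim (no-neighbour-beside-Z (∈─⇒∈─ w∈ w∉T) w∉K w∉Z a∈T uw a-att)

      -- Exactly one end attached to Z is impossible: Z is attached to a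
      -- second vertex of T, which is b; then either K grows by a, or
      -- Z ∪ {a} is a component of G[A] - b missing v.
      one-end-attached : Attached Z a → ¬ Attached Z c → False
      one-end-attached a-att c-unattached with Z-attached-elsewhere a∈T
      ... | t , t∈T , t≢a , t-att with members t∈T
      ...   | inj₁ refl = t≢a refl
      ...   | inj₂ (inj₂ refl) = c-unattached t-att
      ...   | inj₂ (inj₁ refl) with t-att | attached? (K T) a
      ...     | zb , zb∈ , zb-b | yes a-att-K =
        K-cannot-grow (induced-P3 (Z⊆X zb∈) b∈ c∈ zb-b bc (λ zb-c → c-unattached (zb , zb∈ , zb-c))
                                  (≢-sym (T≢ c∈T (Z⊆A-T zb∈))))
                      (Z∉K zb∈) (T∉K b∈T) (T∉K c∈T) a∈T (T≢ a∈T (Z⊆A-T zb∈)) a≢b a≢c a-att-K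
      ...     | _ | no a-unattached-K =
        [ v∉Z , (λ v∈a → v∉X (subst (_∈ X) (≡-sym (x∈⁅y⁆⇒x≡y a v∈a)) a∈)) ]′
          (x∈p∪q⁻ Z ⁅ a ⁆ (cut-components-contain-v b∈
                            (Za-cut-component a-att c-unattached a-unattached-K)))

      an-end-attached : Attached Z a ⊎ Attached Z c
      an-end-attached with Z-attached-elsewhere b∈T
      ... | t , t∈T , t≢b , t-att with members t∈T
      ...   | inj₁ refl = inj₁ t-att
      ...   | inj₂ (inj₁ refl) = ⊥-elim (t≢b refl)
      ...   | inj₂ (inj₂ refl) = inj₂ t-att

    no-stray-vertex : ∀ {a b c} → InducedP3 X a b c → Maximal (triple a b c) →
                      ∀ {z} → z ∈ A ─ triple a b c → z ∉ K (triple a b c) → False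
    no-stray-vertex {a} {b} {c} P maximal z∈ z∉K = by-attachment (attached? S.Z a) (attached? S.Z c)
      where
      module S = Stray triple-is-triple P maximal z∈ z∉K
      module R = Stray (reverse-triple triple-is-triple) (reverse-P3 P) maximal z∈ z∉K
      by-attachment : Dec (Attached S.Z a) → Dec (Attached S.Z c) → False
      by-attachment (yes a-att) (yes c-att) = S.both-ends-attached a-att c-att
      by-attachment (yes a-att) (no c-unattached) = S.one-end-attached a-att c-unattached
      by-attachment (no a-unattached) (yes c-att) = R.one-end-attached c-att a-unattached
      by-attachment (no a-unattached) (no c-unattached) =
        [ a-unattached , c-unattached ]′ S.an-end-attached

    -- Rule 3 applies to an induced path of X with maximal K, since G[A] - T
    -- is then the connected K; by induction on n ∸ |K|, X has no induced path.
    no-P3-in-X : ∀ {a b c} → InducedP3 X a b c → False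
    no-P3-in-X {a} {b} {c} = refute-by-induction μ {P3At} rule3-applies (a , b , c)
      where
      P3At : Fin n × Fin n × Fin n → Set
      P3At (a , b , c) = InducedP3 X a b c
      μ : Fin n × Fin n × Fin n → ℕ
      μ (a , b , c) = n ∸ ∣ K (triple a b c) ∣
      rule3-applies : ∀ i → (∀ j → μ j < μ i → ¬ P3At j) → ¬ P3At i
      rule3-applies (a , b , c) no-larger-K P@(induced-P3 a∈ b∈ c∈ ab bc ¬ac a≢c) =
        exhausted _ (rule3 (X⊆A a∈) (X⊆A b∈) (X⊆A c∈) a≢c ab bc ¬ac A-T-conn)
        where
        T : Subset n
        T = triple a b c
        maximal : Maximal T
        maximal {x} {y} {w} P' K<K' =
          no-larger-K (x , y , w) (∸-monoʳ-< K<K' (∣p∣≤n (K (triple x y w)))) P'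
        v⇝ : ∀ {w} → w ∈ A ─ T → Reach G (A ─ T) v w
        v⇝ {w} w∈ with w ∈? K T
        ... | yes w∈K = ∈componentOf⁻ w∈K
        ... | no w∉K = ⊥-elim (no-stray-vertex P maximal w∈ w∉K)
        A-T-conn : Connected G (A ─ T)
        A-T-conn u∈ w∈ = reach-trans (reach-sym (v⇝ u∈)) (v⇝ w∈)

    impossible : False
    impossible = exhausted _ (rule2 no-rule1 v∈A X-comp
                               (P3-free⇒clique (component-connected X-comp) no-P3-in-X))

  CutComponent : Fin n × Subset n → Set
  CutComponent (v , X) = v ∈ A × Component G (A - v) X

  -- By induction on |X| no cut component exists; two distinct vertices p, q
  -- would give one, the component of q in G[A] - p.
  exhausted-is-trivial : ∀ {p q} → p ∈ A → q ∈ A → p ≢ q → False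
  exhausted-is-trivial {p} {q} p∈ q∈ p≢q =
    no-cut-component (p , componentOf (A - p) q)
                     (p∈ , componentOf-component (x∈p∧x≢y⇒x∈p-y q∈ (≢-sym p≢q)))
    where
    no-cut-component : ∀ i → ¬ CutComponent i
    no-cut-component = refute-by-induction (λ i → ∣ proj₂ i ∣) minimal
      where
      minimal : ∀ i → (∀ j → ∣ proj₂ j ∣ < ∣ proj₂ i ∣ → ¬ CutComponent j) → ¬ CutComponent i
      minimal (v , X) smaller (v∈A , X-comp) = MinimalComponent.impossible v v∈A X X-comp
        (λ v'∈ X'-comp ∣X'∣<∣X∣ → smaller (_ , _) ∣X'∣<∣X∣ (v'∈ , X'-comp))

lemma7 : ∀ {n} (G : SimpleGraph n) (k : ℤ) → Connected G ⊤ →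
         ∀ (A' S : Subset n) (k' : ℤ) →
         Steps G ⟨ ⊤ , ⊥ , k ⟩ ⟨ A' , S , k' ⟩ →
         Exhausted G ⟨ A' , S , k' ⟩ →
         CliqueForest G (∁ S)
lemma7 G k G-conn A' S k' steps exhausted B (B⊆∁S , B-2conn , _) {u} {w} u∈B w∈B u≢w
  with dec G u w
... | yes uw = uw
... | no ¬uw =
  ⊥-elim (Exhaustion.exhausted-is-trivial G A'-conn exhausted (B⊆A' u∈B) (B⊆A' w∈B) u≢w)
  where
  open Invariant G
  final : Invariant ⟨ A' , S , k' ⟩
  final = steps-preserve-invariant steps (G-conn , λ _ _ _ _ _ → ∈⊤)
  A'-conn : Connected G A'
  A'-conn = proj₁ final
  B⊆A' : B ⊆ A'
  B⊆A' = proj₂ final B B-2conn B⊆∁S (λ B-clique → ¬uw (B-clique u∈B w∈B u≢w))
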